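{- Let $k\geq 1$ be an integer and let $a=[a_0;a_1,\dots,a_{k-1}]$ be the even- or odd-length continued fraction expansion of a positive rational number (so $a_0\geq 0$ and $a_i\geq 1$ for $1\leq i<k$). Let $(r_i)$ be defined by $r_{ -1}=r_0=1$ and $r_i=a_{i-1}r_{i-1}+r_{i-2}$ for $1\leq i\leq k$. Let $\mathcal{Z}(a)=\mathbb{Z}\cap[0,r_k)$ if $k$ is odd and $\mathcal{Z}(a)=\mathbb{Z}\cap[r_{k-1}-r_k,\,r_{k-1})$ if $k$ is even. Then every integer $n\in\mathcal{Z}(a)$ can be written uniquely as \[ n=\sum_{i=0}^{k-1}(-1)^i b_i r_i \] where $(b_i)_{0\leq i\leq k-1}$ is an admissible sequence for $a$.
   Context: A finite sequence of integers $(b_i)_{0\leq i<k}$ is called admissible for $a=[a_0;\dots,a_{k-1}]$ if: (i) $0\leq b_i\leq a_i$ for every $0\leq i<k$; (ii) if $i>0$ is odd and $b_i=a_i$, then $b_{i-1}=a_{i-1}$; (iii) if $i>0$ is even and $b_i=0$, then $b_{i-1}=0$. (Equivalently, $r_i=p_{i-1}+q_{i-1}$ where $p_j/q_j$ are the convergents of $a$ with $p_{ -1}=1,q_{ -1}=0$.) -}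

module Defs where

open import Data.Nat using (ℕ; zero; suc; _+_; _*_; _<_; _≤_; _∸_)
open import Data.Bool using (Bool; true; false; not; if_then_else_)
open import Data.Product using (_×_; _,_; proj₁; proj₂)
open import Data.Vec using (Vec; []; _∷_)
open import Data.Integer as ℤ using (ℤ; +_)
open import Relation.Binary.PropositionalEquality using (_≡_)

-- entry i of a vector, read as a function ℕ → ℕ (0 outside the range)
at : {k : ℕ} → Vec ℕ k → ℕ → ℕ
at []       _       = 0
at (x ∷ xs) zero    = x
at (x ∷ xs) (suc i) = at xs i

-- rPair a i = (r_{i-1} , r_i), with r_{-1} = r_0 = 1 and
-- r_i = a_{i-1} r_{i-1} + r_{i-2}
rPair : {k : ℕ} → Vec ℕ k → ℕ → ℕ × ℕ
rPair a zero    = 1 , 1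
rPair a (suc i) = proj₂ (rPair a i) , at a i * proj₂ (rPair a i) + proj₁ (rPair a i)

r : {k : ℕ} → Vec ℕ k → ℕ → ℕ
r a i = proj₂ (rPair a i)

isOdd : ℕ → Bool
isOdd zero    = false
isOdd (suc n) = not (isOdd n)

IsCF : {k : ℕ} → Vec ℕ k → Set
IsCF {k} a = ∀ i → 1 ≤ i → i < k → 1 ≤ at a i

Admissible : {k : ℕ} → Vec ℕ k → Vec ℕ k → Set
Admissible {k} a b =
  (∀ i → i < k → at b i ≤ at a i) ×
  (∀ m → suc (2 * m) < k → at b (suc (2 * m)) ≡ at a (suc (2 * m)) → at b (2 * m) ≡ at a (2 * m)) ×
  (∀ m → suc (suc (2 * m)) < k → at b (suc (suc (2 * m))) ≡ 0 → at b (suc (2 * m)) ≡ 0)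

signedSum : {k : ℕ} → Vec ℕ k → Vec ℕ k → ℕ → ℤ
signedSum a b zero    = + 0
signedSum a b (suc i) = signedSum a b i ℤ.+ ((ℤ.- ℤ.1ℤ) ℤ.^ i) ℤ.* (+ (at b i * r a i))

InZ : {k : ℕ} → Vec ℕ k → ℤ → Set
InZ {k} a n with isOdd k
... | true  = (+ 0 ℤ.≤ n) × (n ℤ.< + r a k)
... | false = ((+ r a (k ∸ 1) ℤ.- + r a k) ℤ.≤ n) × (n ℤ.< + r a (k ∸ 1))

-- Replace the odd-indexed digits b_i by c_i = a_i − b_i (even-indexed ones stay, c_i = b_i). Conditions (ii)
-- and (iii) then both read "c_{i+1} = 0 ⇒ c_i = a_i", and since a_i r_i = r_{i+1} − r_{i−1} telescopes over odd i,
-- n + r_{k−1} (k odd) resp. n + r_k (k even) equals P = 1 + Σ c_i r_i. It remains to see that P is a bijection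
-- from such digit strings of length j onto [r_{j−1}, r_{j−1} + r_j). Inductively, the translates P + c r_j
-- (0 ≤ c ≤ a_j) of this window tile [r_{j−1}, r_j + r_{j+1}), and the window for j + 1 drops exactly the part
-- [r_{j−1}, r_j) of the block c = 0. Inside the window for j, P ≥ r_j holds iff the last digit is maximal, which
-- is what a zero digit c_j demands. (That the dropped part lies in block 0, r_{j−1} ≤ r_j, uses a_i ≥ 1.)
module Submission where

open import Defs
open import Data.Nat using (ℕ; _≤_)
open import Data.Vec using (Vec)
open import Data.Integer using (ℤ)
open import Data.Product using (Σ; _×_)
open import Relation.Binary.PropositionalEquality using (_≡_)

open import Data.Bool using (true; false; not; if_then_else_)
open import Data.Integer using (+_; -[1+_])
import Data.Integer as Int
import Data.Integer.Properties as Intₚ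
import Data.Integer.Tactic.RingSolver as Int-Solver
open import Algebra.Properties.AbelianGroup Intₚ.+-0-abelianGroup using (∙-cancelʳ)
open import Data.Nat using (zero; suc; _+_; _*_; _∸_; _<_; z≤n; s≤s; NonZero; >-nonZero; _<?_)
open import Data.Nat.DivMod using (_/_; _%_; m≡m%n+[m/n]*n; m%n<n; m<n*o⇒m/o<n)
open import Data.Nat.Properties
open import Data.Nat.Tactic.RingSolver using (solve-∀)
open import Data.Product using (_,_; proj₁; proj₂)
open import Data.Sum using (inj₁; inj₂; [_,_]′)
open import Data.Vec using ([]; _∷_)
open import Function using (_∘_; _⇔_; mk⇔; Equivalence)
open import Relation.Binary using (tri<; tri≈; tri>)
open import Relation.Binary.PropositionalEquality using (refl; sym; trans; cong; cong₂; subst; module ≡-Reasoning)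
open import Relation.Nullary using (yes; no; contradiction)

InWindow : ℕ → ℕ → ℕ → Set
InWindow lo len p = lo ≤ p × p < lo + len

module _ {lo len : ℕ} where

  block-<-mono : ∀ {p p′ c c′} → p < lo + len → lo ≤ p′ → c < c′ → p + c * len < p′ + c′ * len
  block-<-mono {p} {p′} {c} {c′} p<hi lo≤p′ c<c′ = begin-strict
    p + c * len          <⟨ +-monoˡ-< (c * len) p<hi ⟩
    lo + len + c * len   ≡⟨ +-assoc lo len (c * len) ⟩
    lo + suc c * len     ≤⟨ +-mono-≤ lo≤p′ (*-monoˡ-≤ len c<c′) ⟩
    p′ + c′ * len        ∎
    where open ≤-Reasoning

  block-injective : ∀ {p p′ c c′} → InWindow lo len p → InWindow lo len p′ →
                    p + c * len ≡ p′ + c′ * len → c ≡ c′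
  block-injective {c = c} {c′} (lo≤p , p<hi) (lo≤p′ , p′<hi) eq with <-cmp c c′
  ... | tri< c<c′ _ _ = contradiction eq (<⇒≢ (block-<-mono p<hi lo≤p′ c<c′))
  ... | tri≈ _ c≡c′ _ = c≡c′
  ... | tri> _ _ c′<c = contradiction (sym eq) (<⇒≢ (block-<-mono p′<hi lo≤p c′<c))

  block-top⇔ : ∀ {p c A} → InWindow lo len p → c ≤ A → (c ≡ A ⇔ A * len + lo ≤ p + c * len)
  block-top⇔ {p} {c} {A} (lo≤p , p<hi) c≤A = mk⇔ top⇒upper upper⇒top
    where
    top⇒upper : c ≡ A → A * len + lo ≤ p + c * len
    top⇒upper refl = subst (_≤ p + c * len) (+-comm lo (c * len)) (+-monoˡ-≤ (c * len) lo≤p)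
    upper⇒top : A * len + lo ≤ p + c * len → c ≡ A
    upper⇒top upper = ≤-antisym c≤A (≮⇒≥ λ c<A →
      <⇒≱ (block-<-mono p<hi ≤-refl c<A) (subst (_≤ p + c * len) (+-comm (A * len) lo) upper))

  block-decompose : ∀ {q} A .{{_ : NonZero len}} → lo ≤ q → q < lo + suc A * len →
                    Σ ℕ λ c → Σ ℕ λ p → c ≤ A × InWindow lo len p × q ≡ p + c * len
  block-decompose {q} A lo≤q q<hi =
    u / len , lo + u % len , c≤A , (m≤m+n lo _ , +-monoʳ-< lo (m%n<n u len)) , q≡
    where
    u = q ∸ lo
    c≤A : u / len ≤ A
    c≤A = ≤-pred (m<n*o⇒m/o<n (+-cancelˡ-< lo u _
            (subst (_< lo + suc A * len) (sym (m+[n∸m]≡n lo≤q)) q<hi)))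
    q≡ : q ≡ lo + u % len + u / len * len
    q≡ = begin
      q                               ≡⟨ m+[n∸m]≡n lo≤q ⟨
      lo + u                          ≡⟨ cong (_+_ lo) (m≡m%n+[m/n]*n u len) ⟩
      lo + (u % len + u / len * len)  ≡⟨ +-assoc lo (u % len) _ ⟨
      lo + u % len + u / len * len    ∎
      where open ≡-Reasoning

toWindow : ∀ {lo len} x → + lo Int.≤ x → x Int.< + (lo + len) → Σ ℕ λ q → InWindow lo len q × x ≡ + q
toWindow (+ q)    lo≤q q<hi = q , (Intₚ.drop‿+≤+ lo≤q , Intₚ.drop‿+<+ q<hi) , refl
toWindow -[1+ _ ] ()   _

AgreeBelow : ℕ → (ℕ → ℕ) → (ℕ → ℕ) → Set
AgreeBelow j d d′ = ∀ {i} → i < j → d i ≡ d′ i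

extend : (ℕ → ℕ) → ℕ → ℕ → ℕ → ℕ
extend d j c i with i <? j
... | yes _ = d i
... | no  _ = c

extend-below : ∀ d j c → AgreeBelow j d (extend d j c)
extend-below d j c {i} i<j with i <? j
... | yes _   = refl
... | no  i≮j = contradiction i<j i≮j

extend-at : ∀ d j c → extend d j c j ≡ c
extend-at d j c with j <? j
... | yes j<j = contradiction j<j (<-irrefl refl)
... | no  _   = refl

fromFun : ∀ k → (ℕ → ℕ) → Vec ℕ k
fromFun zero    f = []
fromFun (suc k) f = f 0 ∷ fromFun k (f ∘ suc)

at-fromFun : ∀ k f → AgreeBelow k f (at (fromFun k f))
at-fromFun (suc k) f {zero}  _         = refl
at-fromFun (suc k) f {suc i} (s≤s i<k) = at-fromFun k (f ∘ suc) i<k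

at-injective : ∀ {k} (b b′ : Vec ℕ k) → AgreeBelow k (at b) (at b′) → b ≡ b′
at-injective []      []        _    = refl
at-injective (x ∷ b) (x′ ∷ b′) b≗b′ = cong₂ _∷_ (b≗b′ (s≤s z≤n)) (at-injective b b′ (b≗b′ ∘ s≤s))

data EvenOdd : ℕ → Set where
  even : ∀ m → EvenOdd (2 * m)
  odd  : ∀ m → EvenOdd (suc (2 * m))

evenOdd : ∀ n → EvenOdd n
evenOdd zero = even 0
evenOdd (suc n) with evenOdd n
... | even m = odd m
... | odd m  = subst EvenOdd (*-suc 2 m) (even (suc m))

isOdd-double : ∀ m → isOdd (2 * m) ≡ false
isOdd-double zero    = refl
isOdd-double (suc m) = subst (λ n → isOdd n ≡ false) (sym (*-suc 2 m)) (cong (not ∘ not) (isOdd-double m))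

isOdd-1+double : ∀ m → isOdd (suc (2 * m)) ≡ true
isOdd-1+double m = cong not (isOdd-double m)

isOdd-2+double : ∀ m → isOdd (suc (suc (2 * m))) ≡ false
isOdd-2+double m = cong (not ∘ not) (isOdd-double m)

[-1]^i≡±1 : ∀ i → (Int.- Int.1ℤ) Int.^ i ≡ (if isOdd i then Int.-1ℤ else Int.1ℤ)
[-1]^i≡±1 zero = refl
[-1]^i≡±1 (suc i) with isOdd i | [-1]^i≡±1 i
... | true  | σ≡-1 = cong (Int.-1ℤ Int.*_) σ≡-1
... | false | σ≡1  = cong (Int.-1ℤ Int.*_) σ≡1

r-prev : {k : ℕ} → Vec ℕ k → ℕ → ℕ
r-prev a i = proj₁ (rPair a i)

r-pred≡r-prev : ∀ {k} (a : Vec ℕ k) → r a (k ∸ 1) ≡ r-prev a k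
r-pred≡r-prev []      = refl
r-pred≡r-prev (_ ∷ _) = refl

module _ {k : ℕ} (a : Vec ℕ k) where

  value : (ℕ → ℕ) → ℕ → ℕ
  value d zero    = 1
  value d (suc j) = value d j + d j * r a j

  record Digits (j : ℕ) (d : ℕ → ℕ) : Set where
    field
      bounded   : ∀ {i} → i < j → d i ≤ at a i
      zero⇒full : ∀ {i} → suc i < j → d (suc i) ≡ 0 → d i ≡ at a i

  open Digits

  Digits-init : ∀ {j d} → Digits (suc j) d → Digits j d
  Digits-init D = record
    { bounded   = bounded D ∘ m<n⇒m<1+n
    ; zero⇒full = zero⇒full D ∘ m<n⇒m<1+n
    }

  Digits-cong : ∀ {j d d′} → AgreeBelow j d d′ → Digits j d → Digits j d′
  Digits-cong d≗d′ D = record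
    { bounded   = λ i<j → subst (_≤ at a _) (d≗d′ i<j) (bounded D i<j)
    ; zero⇒full = λ 1+i<j d′≡0 →
        trans (sym (d≗d′ (<-trans (n<1+n _) 1+i<j))) (zero⇒full D 1+i<j (trans (d≗d′ 1+i<j) d′≡0))
    }

  value-cong : ∀ {j d d′} → AgreeBelow j d d′ → value d j ≡ value d′ j
  value-cong {zero}  _    = refl
  value-cong {suc j} d≗d′ =
    cong₂ (λ v c → v + c * r a j) (value-cong (d≗d′ ∘ m<n⇒m<1+n)) (d≗d′ ≤-refl)

  window-length : ∀ j → r-prev a j + suc (at a j) * r a j ≡ r a j + r a (suc j)
  window-length j = rearrange (r-prev a j) (at a j) (r a j)
    where
    rearrange : ∀ lo A len → lo + suc A * len ≡ len + (A * len + lo)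
    rearrange = solve-∀

  value-window   : ∀ {j d} → Digits j d → InWindow (r-prev a j) (r a j) (value d j)
  zero⇒top-block : ∀ {j d} → Digits (suc j) d → d j ≡ 0 → r a j ≤ value d j

  value-window {zero}  _ = ≤-refl , ≤-refl
  value-window {suc j} {d} D = lower , upper
    where
    lower : r a j ≤ value d j + d j * r a j
    lower with d j in dj≡
    ... | zero  = subst (r a j ≤_) (sym (+-identityʳ _)) (zero⇒top-block D dj≡)
    ... | suc c = ≤-trans (m≤m+n (r a j) (c * r a j)) (m≤n+m _ (value d j))
    upper : value d j + d j * r a j < r a j + r a (suc j)
    upper = subst (value d j + d j * r a j <_) (window-length j)
                  (block-<-mono (proj₂ (value-window (Digits-init D))) ≤-refl (s≤s (bounded D ≤-refl)))

  zero⇒top-block {zero}  _ _    = ≤-refl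
  zero⇒top-block {suc j} D dj≡0 =
    Equivalence.to (block-top⇔ (value-window (Digits-init (Digits-init D))) (bounded D (m<n⇒m<1+n ≤-refl)))
                   (zero⇒full D ≤-refl dj≡0)

  Digits-extend : ∀ {j d c} → Digits j d → c ≤ at a j → (c ≡ 0 → r a j ≤ value d j) →
                  Digits (suc j) (extend d j c)
  Digits-extend {j} {d} {c} D c≤A zero⇒top = record { bounded = bounded′ ; zero⇒full = zero⇒full′ }
    where
    d′ = extend d j c
    D′ : Digits j d′
    D′ = Digits-cong (extend-below d j c) D
    bounded′ : ∀ {i} → i < suc j → d′ i ≤ at a i
    bounded′ i<1+j with m<1+n⇒m<n∨m≡n i<1+j
    ... | inj₁ i<j  = bounded D′ i<j
    ... | inj₂ refl = subst (_≤ at a j) (sym (extend-at d j c)) c≤A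
    zero⇒full′ : ∀ {i} → suc i < suc j → d′ (suc i) ≡ 0 → d′ i ≡ at a i
    zero⇒full′ 1+i<1+j d′≡0 with m<1+n⇒m<n∨m≡n 1+i<1+j
    ... | inj₁ 1+i<j = zero⇒full D′ 1+i<j d′≡0
    ... | inj₂ refl  = Equivalence.from (block-top⇔ (value-window (Digits-init D′)) (bounded D′ ≤-refl))
                         (subst (r a j ≤_) (value-cong (extend-below d j c))
                                (zero⇒top (trans (sym (extend-at d j c)) d′≡0)))

  value-extend : ∀ d j c → value (extend d j c) (suc j) ≡ value d j + c * r a j
  value-extend d j c =
    cong₂ (λ v c → v + c * r a j) (value-cong (sym ∘ extend-below d j c)) (extend-at d j c)

  r-prev-positive : ∀ j → 1 ≤ r-prev a j
  r-prev-positive zero          = ≤-refl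
  r-prev-positive (suc zero)    = ≤-refl
  r-prev-positive (suc (suc j)) = ≤-trans (r-prev-positive j) (m≤n+m _ _)

  r-nonZero : ∀ j → NonZero (r a j)
  r-nonZero j = >-nonZero (r-prev-positive (suc j))

  r-prev≤r : IsCF a → ∀ {j} → j ≤ k → r-prev a j ≤ r a j
  r-prev≤r cf {zero}        _     = ≤-refl
  r-prev≤r cf {suc zero}    _     = m≤n+m 1 _
  r-prev≤r cf {suc (suc j)} 2+j≤k = ≤-trans r≤A*r (m≤m+n _ _)
    where
    r≤A*r : r a (suc j) ≤ at a (suc j) * r a (suc j)
    r≤A*r = subst (_≤ at a (suc j) * r a (suc j)) (*-identityˡ _)
                  (*-monoˡ-≤ (r a (suc j)) (cf (suc j) (s≤s z≤n) 2+j≤k))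

  digits-exist : IsCF a → ∀ {j q} → j ≤ k → InWindow (r-prev a j) (r a j) q →
                 Σ (ℕ → ℕ) λ d → Digits j d × value d j ≡ q
  digits-exist cf {zero} _ (1≤q , q<2) =
    (λ _ → 0) , record { bounded = λ () ; zero⇒full = λ () } , ≤-antisym 1≤q (≤-pred q<2)
  digits-exist cf {suc j} {q} 1+j≤k (r≤q , q<hi)
    with block-decompose (at a j) {{r-nonZero j}} (≤-trans (r-prev≤r cf (<⇒≤ 1+j≤k)) r≤q)
                         (subst (q <_) (sym (window-length j)) q<hi)
  ... | c , p , c≤A , p∈W , q≡p+cr with digits-exist cf (<⇒≤ 1+j≤k) p∈W
  ... | d , D , value≡p =
    extend d j c , Digits-extend D c≤A zero⇒top ,
    trans (value-extend d j c) (trans (cong (λ v → v + c * r a j) value≡p) (sym q≡p+cr))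
    where
    zero⇒top : c ≡ 0 → r a j ≤ value d j
    zero⇒top refl = subst (r a j ≤_) (trans q≡p+cr (trans (+-identityʳ p) (sym value≡p))) r≤q

  digits-unique : ∀ {j d d′} → Digits j d → Digits j d′ → value d j ≡ value d′ j → AgreeBelow j d d′
  digits-unique {suc j} {d} {d′} D D′ eq i<1+j =
    [ digits-unique (Digits-init D) (Digits-init D′) same-value , (λ { refl → same-digit }) ]′
      (m<1+n⇒m<n∨m≡n i<1+j)
    where
    same-digit : d j ≡ d′ j
    same-digit = block-injective (value-window (Digits-init D)) (value-window (Digits-init D′)) eq
    same-value : value d j ≡ value d′ j
    same-value = +-cancelʳ-≡ _ _ _ (trans eq (cong (λ c → value d′ j + c * r a j) (sym same-digit)))

  flipOdd : (ℕ → ℕ) → ℕ → ℕ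
  flipOdd g i = if isOdd i then at a i ∸ g i else g i

  flipOdd-even : ∀ g {i} → isOdd i ≡ false → flipOdd g i ≡ g i
  flipOdd-even g i-even rewrite i-even = refl

  flipOdd-odd : ∀ g {i} → isOdd i ≡ true → flipOdd g i ≡ at a i ∸ g i
  flipOdd-odd g i-odd rewrite i-odd = refl

  flipOdd-≤ : ∀ g i → g i ≤ at a i → flipOdd g i ≤ at a i
  flipOdd-≤ g i gi≤ai with isOdd i
  ... | true  = m∸n≤m (at a i) (g i)
  ... | false = gi≤ai

  flipOdd-involutive : ∀ g i → g i ≤ at a i → flipOdd (flipOdd g) i ≡ g i
  flipOdd-involutive g i gi≤ai with isOdd i
  ... | true  = m∸[m∸n]≡n gi≤ai
  ... | false = refl

  flipOdd-cong : ∀ g g′ i → g i ≡ g′ i → flipOdd g i ≡ flipOdd g′ i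
  flipOdd-cong g g′ i = cong (λ x → if isOdd i then at a i ∸ x else x)

  flipOdd-injective : ∀ g g′ i → g i ≤ at a i → g′ i ≤ at a i →
                      flipOdd g i ≡ flipOdd g′ i → g i ≡ g′ i
  flipOdd-injective g g′ i g≤a g′≤a eq = begin
    g i                       ≡⟨ flipOdd-involutive g i g≤a ⟨
    flipOdd (flipOdd g) i     ≡⟨ flipOdd-cong (flipOdd g) (flipOdd g′) i eq ⟩
    flipOdd (flipOdd g′) i    ≡⟨ flipOdd-involutive g′ i g′≤a ⟩
    g′ i                      ∎
    where open ≡-Reasoning

  admissible⇒digits : ∀ b → Admissible a b → Digits k (flipOdd (at b))
  admissible⇒digits b (b≤a , full⇒full , zero⇒zero) = record
    { bounded   = λ {i} i<k → flipOdd-≤ (at b) i (b≤a i i<k)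
    ; zero⇒full = λ {i} → zero⇒full′ (evenOdd i)
    }
    where
    c = flipOdd (at b)
    zero⇒full′ : ∀ {i} → EvenOdd i → suc i < k → c (suc i) ≡ 0 → c i ≡ at a i
    zero⇒full′ (even m) 1+i<k c≡0 = trans (flipOdd-even (at b) (isOdd-double m)) (full⇒full m 1+i<k b≡a)
      where
      b≡a : at b (suc (2 * m)) ≡ at a (suc (2 * m))
      b≡a = ≤-antisym (b≤a _ 1+i<k)
              (m∸n≡0⇒m≤n (trans (sym (flipOdd-odd (at b) (isOdd-1+double m))) c≡0))
    zero⇒full′ (odd m) 2+i<k c≡0 = begin
      c (suc (2 * m))                          ≡⟨ flipOdd-odd (at b) (isOdd-1+double m) ⟩
      at a (suc (2 * m)) ∸ at b (suc (2 * m))  ≡⟨ cong (at a (suc (2 * m)) ∸_) (zero⇒zero m 2+i<k b≡0) ⟩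
      at a (suc (2 * m))                       ∎
      where
      open ≡-Reasoning
      b≡0 : at b (suc (suc (2 * m))) ≡ 0
      b≡0 = trans (sym (flipOdd-even (at b) (isOdd-2+double m))) c≡0

  digits⇒admissible : ∀ {d} b → Digits k d → AgreeBelow k (flipOdd d) (at b) → Admissible a b
  digits⇒admissible {d} b D d≗b = b≤a , full⇒full , zero⇒zero
    where
    b≤a : ∀ i → i < k → at b i ≤ at a i
    b≤a i i<k = subst (_≤ at a i) (d≗b i<k) (flipOdd-≤ d i (bounded D i<k))
    full⇒full : ∀ m → suc (2 * m) < k →
                at b (suc (2 * m)) ≡ at a (suc (2 * m)) → at b (2 * m) ≡ at a (2 * m)
    full⇒full m 1+2m<k b≡a = begin
      at b (2 * m)       ≡⟨ d≗b (<-trans (n<1+n _) 1+2m<k) ⟨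
      flipOdd d (2 * m)  ≡⟨ flipOdd-even d (isOdd-double m) ⟩
      d (2 * m)          ≡⟨ zero⇒full D 1+2m<k d≡0 ⟩
      at a (2 * m)       ∎
      where
      open ≡-Reasoning
      d≡0 : d (suc (2 * m)) ≡ 0
      d≡0 = ∸-cancelˡ-≡ (bounded D 1+2m<k) z≤n
              (trans (sym (flipOdd-odd d (isOdd-1+double m))) (trans (d≗b 1+2m<k) b≡a))
    zero⇒zero : ∀ m → suc (suc (2 * m)) < k →
                at b (suc (suc (2 * m))) ≡ 0 → at b (suc (2 * m)) ≡ 0
    zero⇒zero m 2+2m<k b≡0 = begin
      at b (suc (2 * m))                       ≡⟨ d≗b (<-trans (n<1+n _) 2+2m<k) ⟨
      flipOdd d (suc (2 * m))                  ≡⟨ flipOdd-odd d (isOdd-1+double m) ⟩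
      at a (suc (2 * m)) ∸ d (suc (2 * m))     ≡⟨ cong (at a (suc (2 * m)) ∸_) (zero⇒full D 2+2m<k d≡0) ⟩
      at a (suc (2 * m)) ∸ at a (suc (2 * m))  ≡⟨ n∸n≡0 (at a (suc (2 * m))) ⟩
      0                                        ∎
      where
      open ≡-Reasoning
      d≡0 : d (suc (suc (2 * m))) ≡ 0
      d≡0 = trans (sym (flipOdd-even d (isOdd-2+double m))) (trans (d≗b 2+2m<k) b≡0)

  -- 1 + Σ_{odd i < j} a_i r_i, after telescoping
  offset : ℕ → ℕ
  offset j = if isOdd j then r-prev a j else r a j

  signedSum+offset : ∀ b j → (∀ {i} → i < j → at b i ≤ at a i) →
                     signedSum a b j Int.+ + offset j ≡ + value (flipOdd (at b)) j
  signedSum+offset b zero    _   = refl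
  signedSum+offset b (suc j) b≤a with isOdd j | [-1]^i≡±1 j | signedSum+offset b j (b≤a ∘ m<n⇒m<1+n)
  ... | false | σ≡1 | ih = begin
    S Int.+ (Int.- Int.1ℤ) Int.^ j Int.* B Int.+ + r a j
      ≡⟨ cong (λ σ → S Int.+ σ Int.* B Int.+ + r a j) σ≡1 ⟩
    S Int.+ Int.1ℤ Int.* B Int.+ + r a j
      ≡⟨ even-step S B (+ r a j) ⟩
    (S Int.+ + r a j) Int.+ B
      ≡⟨ cong (Int._+ B) ih ⟩
    + (value (flipOdd (at b)) j + at b j * r a j)
      ∎
    where
    open ≡-Reasoning
    S = signedSum a b j
    B = + (at b j * r a j)
    even-step : ∀ S B R → S Int.+ Int.1ℤ Int.* B Int.+ R ≡ (S Int.+ R) Int.+ B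
    even-step = Int-Solver.solve-∀
  ... | true  | σ≡-1 | ih = begin
    S Int.+ (Int.- Int.1ℤ) Int.^ j Int.* B Int.+ + r a (suc j)
      ≡⟨ cong₂ (λ σ x → S Int.+ σ Int.* B Int.+ + (x + r-prev a j)) σ≡-1 (sym X+B≡A*r) ⟩
    S Int.+ Int.-1ℤ Int.* B Int.+ ((X Int.+ B) Int.+ R)
      ≡⟨ odd-step S B X R ⟩
    (S Int.+ R) Int.+ X
      ≡⟨ cong (Int._+ X) ih ⟩
    + (value (flipOdd (at b)) j + (at a j ∸ at b j) * r a j)
      ∎
    where
    open ≡-Reasoning
    S = signedSum a b j
    B = + (at b j * r a j)
    X = + ((at a j ∸ at b j) * r a j)
    R = + r-prev a j
    X+B≡A*r : (at a j ∸ at b j) * r a j + at b j * r a j ≡ at a j * r a j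
    X+B≡A*r = trans (sym (*-distribʳ-+ (r a j) (at a j ∸ at b j) (at b j)))
                    (cong (_* r a j) (m∸n+n≡m (b≤a (n<1+n j))))
    odd-step : ∀ S B X R → S Int.+ Int.-1ℤ Int.* B Int.+ ((X Int.+ B) Int.+ R) ≡ (S Int.+ R) Int.+ X
    odd-step = Int-Solver.solve-∀

  InZ⇒window : ∀ {n} → InZ a n → Σ ℕ λ q → InWindow (r-prev a k) (r a k) q × n Int.+ + offset k ≡ + q
  InZ⇒window {n} n∈Z with isOdd k | n∈Z
  ... | true  | 0≤n , n<r =
    toWindow (n Int.+ + r-prev a k) (Intₚ.+-monoˡ-≤ (+ r-prev a k) 0≤n)
             (subst (n Int.+ + r-prev a k Int.<_) (cong +_ (+-comm (r a k) (r-prev a k)))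
                    (Intₚ.+-monoˡ-< (+ r-prev a k) n<r))
  ... | false | lo≤n , n<r′ rewrite r-pred≡r-prev a =
    toWindow (n Int.+ + r a k)
             (subst (Int._≤ n Int.+ + r a k) (minus-plus (+ r-prev a k) (+ r a k))
                    (Intₚ.+-monoˡ-≤ (+ r a k) lo≤n))
             (Intₚ.+-monoˡ-< (+ r a k) n<r′)
    where
    minus-plus : ∀ x y → x Int.- y Int.+ y ≡ x
    minus-plus = Int-Solver.solve-∀

  representation-exists : IsCF a → ∀ {n} → InZ a n →
                          Σ (Vec ℕ k) λ b → Admissible a b × n ≡ signedSum a b k
  representation-exists cf n∈Z with InZ⇒window n∈Z
  ... | q , q∈W , n+o≡q with digits-exist cf ≤-refl q∈W
  ... | d , D , value≡q = b , admissible , ∙-cancelʳ (+ offset k) _ _ (trans n+o≡q (sym sum+o≡q))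
    where
    b = fromFun k (flipOdd d)
    admissible : Admissible a b
    admissible = digits⇒admissible b D (at-fromFun k (flipOdd d))
    flipped-back : AgreeBelow k (flipOdd (at b)) d
    flipped-back {i} i<k = trans (flipOdd-cong (at b) (flipOdd d) i (sym (at-fromFun k (flipOdd d) i<k)))
                                 (flipOdd-involutive d i (bounded D i<k))
    sum+o≡q : signedSum a b k Int.+ + offset k ≡ + q
    sum+o≡q = trans (signedSum+offset b k (proj₁ admissible _))
                    (cong +_ (trans (value-cong flipped-back) value≡q))

  representation-unique : ∀ {n} (b b′ : Vec ℕ k) → Admissible a b → Admissible a b′ →
                          n ≡ signedSum a b k → n ≡ signedSum a b′ k → b ≡ b′
  representation-unique b b′ adm adm′ n≡s n≡s′ =
    at-injective b b′ λ {i} i<k →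
      flipOdd-injective (at b) (at b′) i (proj₁ adm i i<k) (proj₁ adm′ i i<k) (same-digits i<k)
    where
    same-value : value (flipOdd (at b)) k ≡ value (flipOdd (at b′)) k
    same-value = Intₚ.+-injective (begin
      + value (flipOdd (at b)) k         ≡⟨ signedSum+offset b k (proj₁ adm _) ⟨
      signedSum a b k Int.+ + offset k   ≡⟨ cong (Int._+ + offset k) (trans (sym n≡s) n≡s′) ⟩
      signedSum a b′ k Int.+ + offset k  ≡⟨ signedSum+offset b′ k (proj₁ adm′ _) ⟩
      + value (flipOdd (at b′)) k        ∎)
      where open ≡-Reasoning
    same-digits : AgreeBelow k (flipOdd (at b)) (flipOdd (at b′))
    same-digits = digits-unique (admissible⇒digits b adm) (admissible⇒digits b′ adm′) same-value

theoremA : (k : ℕ) → 1 ≤ k → (a : Vec ℕ k) → IsCF a →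
    (n : ℤ) → InZ a n →
      Σ (Vec ℕ k) (λ b → Admissible a b × n ≡ signedSum a b k) ×
      ((b b′ : Vec ℕ k) → Admissible a b → Admissible a b′ →
        n ≡ signedSum a b k → n ≡ signedSum a b′ k → b ≡ b′)
theoremA k _ a cf n n∈Z = representation-exists a cf n∈Z , representation-unique a
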